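{- Let $P_j=\{t_1,\dots,t_j\}$ be any pot. Then $P_j$ realizes a disconnected graph of order $n$ if and only if there is a tile distribution $(R_1,\dots,R_j)$ of a graph of order $n$ realized by $P_j$ such that \[ (R_1,\dots,R_j)=\sum_{i=1}^{m}(R_{1i},\dots,R_{ji}), \] where each $j$-tuple $(R_{1i},\dots,R_{ji})$ is the tile distribution of a (nonempty) graph of order less than $n$ realized by $P_j$.
   Context: Graphs are loopless multigraphs with at least one vertex; the order of a graph is its number of vertices. A tile is a vertex with half-edges (cohesive ends) labeled by letters $a_1,a_2,\dots$ and their complements $\hat a_1,\hat a_2,\dots$; a tile type is a multiset of such labels. A pot is a set of tile types such that whenever a cohesive-end type appears on some tile, its complement appears on some tile of the pot. A graph $G$ is realized by a pot $P$ if each vertex $v$ can be assigned a tile type $t\in P$ together with a bijection between the cohesive ends of $t$ and the edge-ends (half-edges) at $v$, such that for every edge the two half-edges are assigned complementary cohesive ends ($a_i$ and $\hat a_i$). A tile distribution $(R_1,\dots,R_j)$ of such a realization records that exactly $R_k$ vertices are assigned tile type $t_k$. -}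

module Defs where

open import Data.Nat using (ℕ; suc; _≤_; _<_)
open import Data.Bool using (Bool; true; false; not)
open import Data.Fin using (Fin; _≟_)
open import Data.Fin.Properties using () renaming (_≟_ to _≟F_)
open import Data.Product using (Σ; ∃; ∃-syntax; _×_; _,_; proj₁; proj₂)
open import Data.List using (List; []; _∷_; map; filter; length; allFin; concatMap)
open import Data.Nat.ListAction using (sum)
open import Data.List.Membership.Propositional using (_∈_)
open import Data.List.Relation.Binary.Permutation.Propositional using (_↭_)
open import Relation.Binary.PropositionalEquality using (_≡_; _≢_)
open import Relation.Nullary using (¬_)

-- Parallel edges are allowed; loops are not.

record Graph (n : ℕ) : Set where
  field
    nonempty : 1 ≤ n
    m        : ℕ
    end      : Fin m → Bool → Fin n
    loopless : ∀ e → end e false ≢ end e true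

open Graph public

HalfEdge : ∀ {n} → Graph n → Set
HalfEdge G = Fin (m G) × Bool

allHalfEdges : ∀ {n} (G : Graph n) → List (HalfEdge G)
allHalfEdges G = concatMap (λ e → (e , false) ∷ (e , true) ∷ []) (allFin (m G))

halfEdgesAt : ∀ {n} (G : Graph n) → Fin n → List (HalfEdge G)
halfEdgesAt G v = filter (λ h → end G (proj₁ h) (proj₂ h) ≟F v) (allHalfEdges G)

Adjacent : ∀ {n} → Graph n → Fin n → Fin n → Set
Adjacent G u v = ∃[ e ] ∃[ b ] (end G e b ≡ u × end G e (not b) ≡ v)

data Reachable {n} (G : Graph n) : Fin n → Fin n → Set where
  here : ∀ {u} → Reachable G u u
  step : ∀ {u v w} → Adjacent G u v → Reachable G v w → Reachable G u w

Disconnected : ∀ {n} → Graph n → Set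
Disconnected G = ∃[ u ] ∃[ v ] ¬ Reachable G u v

-- Cohesive ends: (i , false) is a_i, (i , true) is \hat a_i.

Label : Set
Label = ℕ × Bool

complement : Label → Label
complement (i , b) = (i , not b)

-- a tile type is a multiset of labels (a list, compared up to ↭)
TileType : Set
TileType = List Label

record Pot (j : ℕ) : Set where
  field
    tile     : Fin j → TileType
    distinct : ∀ k k' → k ≢ k' → ¬ (tile k ↭ tile k')
    closed   : ∀ k l → l ∈ tile k → ∃[ k' ] (complement l ∈ tile k')

open Pot public

-- Each vertex v gets a tile type τ v; the half-edges
-- get labels λ such that the two halves of every edge carry
-- complementary labels and, at every vertex v, the labels on the
-- half-edges at v are a bijective image of the cohesive ends of
-- the tile τ v (i.e. equal to it as a multiset).

record Realization {j n : ℕ} (P : Pot j) (G : Graph n) : Set where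
  field
    τ         : Fin n → Fin j
    label     : HalfEdge G → Label
    compl     : ∀ e → label (e , true) ≡ complement (label (e , false))
    bijective : ∀ v → map label (halfEdgesAt G v) ↭ tile P (τ v)

open Realization public

distribution : ∀ {j n} {P : Pot j} {G : Graph n} → Realization P G → Fin j → ℕ
distribution {n = n} ρ k = length (filter (λ v → τ ρ v ≟F k) (allFin n))

Realizes : ∀ {j n} → Pot j → Graph n → Set
Realizes P G = Realization P G

RealizesDisconnected : ∀ {j} → Pot j → ℕ → Set
RealizesDisconnected P n = Σ (Graph n) λ G → Disconnected G × Realizes P G

IsTileDistribution : ∀ {j} → Pot j → ℕ → (Fin j → ℕ) → Set
IsTileDistribution P n R =
  Σ (Graph n) λ G → Σ (Realization P G) λ ρ → ∀ k → distribution ρ k ≡ R k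

DecomposesBelow : ∀ {j} → Pot j → ℕ → (Fin j → ℕ) → Set
DecomposesBelow {j} P n R =
  ∃[ m ] Σ (Fin m → ℕ) λ ord → Σ (Fin m → Fin j → ℕ) λ Rs →
    (∀ i → ord i < n) ×
    (∀ i → IsTileDistribution P (ord i) (Rs i)) ×
    (∀ k → R k ≡ sum (map (λ i → Rs i k) (allFin m)))

{-# OPTIONS --safe #-}
-- A disconnected graph is the disjoint union of the connected component of a vertex
-- (computed as the least edge-closed vertex set containing it) and the remaining
-- vertices; restricting a realization to the two parts writes its tile distribution
-- as the sum of the distributions of two smaller graphs.  Conversely, the disjoint
-- union of graphs realizing the summands realizes the sum, and it is disconnected
-- as soon as there are two summands.  Counting vertices (the entries of a tile
-- distribution add up to the order) shows that this union has order n, and, since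
-- every summand has order below n, that there are at least two summands.
module Submission where

open import Defs
open import Data.Nat using (ℕ; zero; suc; _+_; _≤_; _<_; z≤n; s≤s)
open import Data.Nat.Properties
  using (+-commutativeSemigroup; ≤-trans; m≤m+n; +-identityʳ; +-suc; +-monoʳ-≤; <-irrefl; <⇒≱; <-≤-trans; m<m+n; m<n+m)
open import Data.Nat.ListAction using (sum)
open import Algebra.Properties.CommutativeSemigroup +-commutativeSemigroup
  using () renaming (interchange to +-interchange)
open import Data.Bool using (Bool; true; false; not; if_then_else_)
open import Data.Fin using (Fin; zero; suc; fromℕ<)
open import Data.Fin.Properties using (+↔⊎; any?) renaming (_≟_ to _≟F_)
open import Data.Fin.Permutation using (↔⇒≡)
open import Data.Fin.Subset using (Subset; ⁅_⁆; _∪_; ∣_∣) renaming (_∈_ to _∈ₛ_; _∉_ to _∉ₛ_)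
open import Data.Fin.Subset.Properties
  using (_∈?_; ∣p∣≤n; ∣⁅x⁆∣≡1; x∈⁅x⁆; x∈⁅y⁆⇒x≡y; x∈p∪q⁺; x∈p∪q⁻; p⊆p∪q; p⊂q⇒∣p∣<∣q∣)
open import Data.Sum as Sum using (_⊎_; inj₁; inj₂; [_,_]′)
open import Data.Sum.Properties using (inj₁-injective; inj₂-injective)
open import Data.Sum.Algebra using (⊎-assoc; ⊎-comm)
open import Data.Sum.Function.Propositional using (_⊎-↔_)
open import Data.Product using (Σ; ∃; ∃-syntax; _×_; _,_; proj₁; proj₂)
open import Data.Empty using (⊥-elim)
open import Data.List using (List; []; _∷_; map; filter; length; allFin; concatMap; tabulate; _++_)
open import Data.List.Properties
  using (map-∘; map-cong; length-++; length-map; length-tabulate; map-tabulate; tabulate-cong; filter-≐)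
open import Data.List.Membership.Propositional using (_∈_)
open import Data.List.Membership.Propositional.Properties
  using (∈-filter⁺; ∈-filter⁻; ∈-map⁺; ∈-map⁻; ∈-++⁺ˡ; ∈-++⁺ʳ; ∈-++⁻; ∈-allFin)
open import Data.List.Membership.Propositional.Properties.WithK using (unique∧set⇒bag)
open import Data.List.Relation.Binary.BagAndSetEquality using (∼bag⇒↭)
open import Data.List.Relation.Binary.Permutation.Propositional using (_↭_; ↭-sym; ↭-trans; ↭-reflexive)
open import Data.List.Relation.Binary.Permutation.Propositional.Properties using (↭-length; map⁺)
open import Data.List.Relation.Unary.All as All using (All)
open import Data.List.Relation.Unary.AllPairs using ([]; _∷_)
open import Data.List.Relation.Unary.Any using (here; there)
open import Data.List.Relation.Unary.Unique.Propositional using (Unique)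
import Data.List.Relation.Unary.Unique.Propositional.Properties as Unique
open import Function using (_∘_; id)
open import Function.Bundles using (_↔_; Inverse; Injection; _⇔_; mk⇔)
open import Function.Properties.Inverse using (↔-refl; ↔-sym; ↔-trans; ↔⇒↣)
open import Level using (0ℓ)
open import Relation.Binary.PropositionalEquality
open import Relation.Nullary using (¬_; Dec; yes; no; does; ¬?)
open import Relation.Nullary.Decidable using (map′; _×-dec_; _⊎-dec_)
open import Relation.Unary using (Pred; Decidable; ∁)

open Inverse

unique-↭ : ∀ {A : Set} {xs ys : List A} → Unique xs → Unique ys →
  (∀ {x} → x ∈ xs → x ∈ ys) → (∀ {x} → x ∈ ys → x ∈ xs) → xs ↭ ys
unique-↭ uxs uys to from = ∼bag⇒↭ (unique∧set⇒bag uxs uys (mk⇔ to from))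

inverse-injective : ∀ {A B : Set} (f : A ↔ B) {x y} → to f x ≡ to f y → x ≡ y
inverse-injective f = Injection.injective (↔⇒↣ f)

Fin⇒0< : ∀ {a} → Fin a → 0 < a
Fin⇒0< {suc a} _ = s≤s z≤n

module _ {k : ℕ} where

  private
    bothEnds : Fin k → List (Fin k × Bool)
    bothEnds e = (e , false) ∷ (e , true) ∷ []

  ∈-concatMap-bothEnds⁻ : ∀ es {h} → h ∈ concatMap bothEnds es → proj₁ h ∈ es
  ∈-concatMap-bothEnds⁻ (e ∷ es) (here refl)         = here refl
  ∈-concatMap-bothEnds⁻ (e ∷ es) (there (here refl)) = here refl
  ∈-concatMap-bothEnds⁻ (e ∷ es) (there (there p))   = there (∈-concatMap-bothEnds⁻ es p)

  ∈-concatMap-bothEnds⁺ : ∀ es {e} b → e ∈ es → (e , b) ∈ concatMap bothEnds es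
  ∈-concatMap-bothEnds⁺ (e ∷ es) false (here refl) = here refl
  ∈-concatMap-bothEnds⁺ (e ∷ es) true  (here refl) = there (here refl)
  ∈-concatMap-bothEnds⁺ (e ∷ es) b     (there p)   = there (there (∈-concatMap-bothEnds⁺ es b p))

  unique-concatMap-bothEnds : ∀ es → Unique es → Unique (concatMap bothEnds es)
  unique-concatMap-bothEnds []       _            = []
  unique-concatMap-bothEnds (e ∷ es) (e∉es ∷ ues) =
    ((λ ()) All.∷ fresh) ∷ (fresh ∷ unique-concatMap-bothEnds es ues)
    where
    fresh : ∀ {b} → All (λ h → (e , b) ≢ h) (concatMap bothEnds es)
    fresh = All.tabulate λ p eq → All.lookup e∉es (∈-concatMap-bothEnds⁻ es p) (cong proj₁ eq)

module _ {n} (G : Graph n) where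

  ∈-allHalfEdges : ∀ h → h ∈ allHalfEdges G
  ∈-allHalfEdges (e , b) = ∈-concatMap-bothEnds⁺ (allFin (m G)) b (∈-allFin e)

  allHalfEdges-unique : Unique (allHalfEdges G)
  allHalfEdges-unique = unique-concatMap-bothEnds (allFin (m G)) (Unique.allFin⁺ (m G))

  ∈-halfEdgesAt⁺ : ∀ {v} h → end G (proj₁ h) (proj₂ h) ≡ v → h ∈ halfEdgesAt G v
  ∈-halfEdgesAt⁺ {v} h = ∈-filter⁺ (λ h → end G (proj₁ h) (proj₂ h) ≟F v) (∈-allHalfEdges h)

  ∈-halfEdgesAt⁻ : ∀ {v h} → h ∈ halfEdgesAt G v → end G (proj₁ h) (proj₂ h) ≡ v
  ∈-halfEdgesAt⁻ {v} p = proj₂ (∈-filter⁻ (λ h → end G (proj₁ h) (proj₂ h) ≟F v) {xs = allHalfEdges G} p)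

  halfEdgesAt-unique : ∀ v → Unique (halfEdgesAt G v)
  halfEdgesAt-unique v = Unique.filter⁺ (λ h → end G (proj₁ h) (proj₂ h) ≟F v) allHalfEdges-unique

module _ {a b n} (V : (Fin a ⊎ Fin b) ↔ Fin n) {P : Pred (Fin n) 0ℓ} (P? : Decidable P) where

  private
    ι₁ : Fin a → Fin n
    ι₁ = to V ∘ inj₁
    ι₂ : Fin b → Fin n
    ι₂ = to V ∘ inj₂
    L₁ : List (Fin a)
    L₁ = filter (P? ∘ ι₁) (allFin a)
    L₂ : List (Fin b)
    L₂ = filter (P? ∘ ι₂) (allFin b)

    filter-↭ : filter P? (allFin n) ↭ map ι₁ L₁ ++ map ι₂ L₂
    filter-↭ = unique-↭ (Unique.filter⁺ P? (Unique.allFin⁺ n)) unique-images into outof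
      where
      unique-images : Unique (map ι₁ L₁ ++ map ι₂ L₂)
      unique-images = Unique.++⁺
        (Unique.map⁺ (inj₁-injective ∘ inverse-injective V) (Unique.filter⁺ (P? ∘ ι₁) (Unique.allFin⁺ a)))
        (Unique.map⁺ (inj₂-injective ∘ inverse-injective V) (Unique.filter⁺ (P? ∘ ι₂) (Unique.allFin⁺ b)))
        disjoint
        where
        disjoint : ∀ {v} → ¬ (v ∈ map ι₁ L₁ × v ∈ map ι₂ L₂)
        disjoint (p , q) with ∈-map⁻ ι₁ p | ∈-map⁻ ι₂ q
        ... | _ , _ , refl | _ , _ , eq with inverse-injective V eq
        ...   | ()
      into : ∀ {v} → v ∈ filter P? (allFin n) → v ∈ map ι₁ L₁ ++ map ι₂ L₂
      into {v} p with from V v | strictlyInverseˡ V v | proj₂ (∈-filter⁻ P? {xs = allFin n} p)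
      ... | inj₁ x | refl | Pv = ∈-++⁺ˡ (∈-map⁺ ι₁ (∈-filter⁺ (P? ∘ ι₁) (∈-allFin x) Pv))
      ... | inj₂ y | refl | Pv = ∈-++⁺ʳ (map ι₁ L₁) (∈-map⁺ ι₂ (∈-filter⁺ (P? ∘ ι₂) (∈-allFin y) Pv))
      outof : ∀ {v} → v ∈ map ι₁ L₁ ++ map ι₂ L₂ → v ∈ filter P? (allFin n)
      outof p with ∈-++⁻ (map ι₁ L₁) p
      ... | inj₁ p₁ with ∈-map⁻ ι₁ p₁
      ...   | x , q , refl = ∈-filter⁺ P? (∈-allFin _) (proj₂ (∈-filter⁻ (P? ∘ ι₁) {xs = allFin a} q))
      outof p | inj₂ p₂ with ∈-map⁻ ι₂ p₂
      ...   | y , q , refl = ∈-filter⁺ P? (∈-allFin _) (proj₂ (∈-filter⁻ (P? ∘ ι₂) {xs = allFin b} q))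

  length-filter-↔⊎ : length (filter P? (allFin n)) ≡
    length (filter (P? ∘ to V ∘ inj₁) (allFin a)) + length (filter (P? ∘ to V ∘ inj₂) (allFin b))
  length-filter-↔⊎ = begin
    length (filter P? (allFin n))               ≡⟨ ↭-length filter-↭ ⟩
    length (map ι₁ L₁ ++ map ι₂ L₂)             ≡⟨ length-++ (map ι₁ L₁) ⟩
    length (map ι₁ L₁) + length (map ι₂ L₂)     ≡⟨ cong₂ _+_ (length-map ι₁ L₁) (length-map ι₂ L₂) ⟩
    length L₁ + length L₂                       ∎
    where open ≡-Reasoning

record DisjointUnion {n a b} (G : Graph n) (G₁ : Graph a) (G₂ : Graph b) : Set where
  field
    vertices : (Fin a ⊎ Fin b) ↔ Fin n
    edges    : (Fin (m G₁) ⊎ Fin (m G₂)) ↔ Fin (m G)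
    end-inj₁ : ∀ e s → end G (to edges (inj₁ e)) s ≡ to vertices (inj₁ (end G₁ e s))
    end-inj₂ : ∀ e s → end G (to edges (inj₂ e)) s ≡ to vertices (inj₂ (end G₂ e s))

open DisjointUnion

module _ {n a b} {G : Graph n} {G₁ : Graph a} {G₂ : Graph b} (U : DisjointUnion G G₁ G₂) where

  DisjointUnion-swap : DisjointUnion G G₂ G₁
  DisjointUnion-swap = record
    { vertices = ↔-trans (⊎-comm _ _) (vertices U)
    ; edges    = ↔-trans (⊎-comm _ _) (edges U)
    ; end-inj₁ = end-inj₂ U
    ; end-inj₂ = end-inj₁ U
    }

  DisjointUnion-order : a + b ≡ n
  DisjointUnion-order = ↔⇒≡ (↔-trans +↔⊎ (vertices U))

  embed₁ : HalfEdge G₁ → HalfEdge G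
  embed₁ (e , s) = to (edges U) (inj₁ e) , s

  halfEdgesAt-inj₁ : ∀ x → halfEdgesAt G (to (vertices U) (inj₁ x)) ↭ map embed₁ (halfEdgesAt G₁ x)
  halfEdgesAt-inj₁ x =
    unique-↭ (halfEdgesAt-unique G _) (Unique.map⁺ embed₁-injective (halfEdgesAt-unique G₁ x)) into outof
    where
    embed₁-injective : ∀ {h h'} → embed₁ h ≡ embed₁ h' → h ≡ h'
    embed₁-injective {e , s} {e' , s'} eq
      with refl ← inj₁-injective (inverse-injective (edges U) (cong proj₁ eq)) | refl ← cong proj₂ eq = refl
    into : ∀ {h} → h ∈ halfEdgesAt G (to (vertices U) (inj₁ x)) → h ∈ map embed₁ (halfEdgesAt G₁ x)
    into {e , s} p with from (edges U) e | strictlyInverseˡ (edges U) e | ∈-halfEdgesAt⁻ G p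
    ... | inj₁ e₁ | refl | at = ∈-map⁺ embed₁ (∈-halfEdgesAt⁺ G₁ (e₁ , s)
          (inj₁-injective (inverse-injective (vertices U) (trans (sym (end-inj₁ U e₁ s)) at))))
    ... | inj₂ e₂ | refl | at with inverse-injective (vertices U) (trans (sym (end-inj₂ U e₂ s)) at)
    ...   | ()
    outof : ∀ {h} → h ∈ map embed₁ (halfEdgesAt G₁ x) → h ∈ halfEdgesAt G (to (vertices U) (inj₁ x))
    outof p with ∈-map⁻ embed₁ p
    ... | (e , s) , q , refl =
          ∈-halfEdgesAt⁺ G _ (trans (end-inj₁ U e s) (cong (to (vertices U) ∘ inj₁) (∈-halfEdgesAt⁻ G₁ q)))

  labelsAt-inj₁ : (ℓ : HalfEdge G → Label) →
    ∀ x → map ℓ (halfEdgesAt G (to (vertices U) (inj₁ x))) ↭ map (ℓ ∘ embed₁) (halfEdgesAt G₁ x)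
  labelsAt-inj₁ ℓ x = ↭-trans (map⁺ ℓ (halfEdgesAt-inj₁ x)) (↭-reflexive (sym (map-∘ (halfEdgesAt G₁ x))))

fibreSize : ∀ {a j} → (Fin a → Fin j) → Fin j → ℕ
fibreSize {a} τ k = length (filter (λ x → τ x ≟F k) (allFin a))

fibreSize-cong : ∀ {a j} {τ τ' : Fin a → Fin j} → (∀ x → τ x ≡ τ' x) → ∀ k → fibreSize τ k ≡ fibreSize τ' k
fibreSize-cong {a} {τ = τ} {τ'} τ≗τ' k =
  cong length (filter-≐ (λ x → τ x ≟F k) (λ x → τ' x ≟F k)
    ((λ {x} eq → trans (sym (τ≗τ' x)) eq) , (λ {x} eq → trans (τ≗τ' x) eq)) (allFin a))

fibreSize-split : ∀ {a b n j} (V : (Fin a ⊎ Fin b) ↔ Fin n) (τ : Fin n → Fin j) k →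
  fibreSize τ k ≡ fibreSize (τ ∘ to V ∘ inj₁) k + fibreSize (τ ∘ to V ∘ inj₂) k
fibreSize-split V τ k = length-filter-↔⊎ V (λ v → τ v ≟F k)

module _ {n a b} {G : Graph n} {G₁ : Graph a} {G₂ : Graph b} (U : DisjointUnion G G₁ G₂) {j} {P : Pot j} where

  restrict₁ : Realization P G → Realization P G₁
  restrict₁ ρ = record
    { τ         = τ ρ ∘ to (vertices U) ∘ inj₁
    ; label     = label ρ ∘ embed₁ U
    ; compl     = compl ρ ∘ to (edges U) ∘ inj₁
    ; bijective = λ x → ↭-trans (↭-sym (labelsAt-inj₁ U (label ρ) x)) (bijective ρ _)
    }

  module _ (ρ₁ : Realization P G₁) (ρ₂ : Realization P G₂) where

    private
      τ-combined : Fin n → Fin j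
      τ-combined v = [ τ ρ₁ , τ ρ₂ ]′ (from (vertices U) v)

      edgeLabel : Fin (m G₁) ⊎ Fin (m G₂) → Bool → Label
      edgeLabel (inj₁ e) s = label ρ₁ (e , s)
      edgeLabel (inj₂ e) s = label ρ₂ (e , s)

      edgeLabel-compl : ∀ e → edgeLabel e true ≡ complement (edgeLabel e false)
      edgeLabel-compl (inj₁ e) = compl ρ₁ e
      edgeLabel-compl (inj₂ e) = compl ρ₂ e

      label-combined : HalfEdge G → Label
      label-combined (e , s) = edgeLabel (from (edges U) e) s

    combine : Realization P G
    combine = record
      { τ         = τ-combined
      ; label     = label-combined
      ; compl     = λ e → edgeLabel-compl (from (edges U) e)
      ; bijective = bijective-combined
      }
      where
      bijective-combined : ∀ v → map label-combined (halfEdgesAt G v) ↭ tile P (τ-combined v)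
      bijective-combined v with from (vertices U) v | strictlyInverseˡ (vertices U) v
      ... | inj₁ x | refl = ↭-trans (labelsAt-inj₁ U label-combined x)
                              (↭-trans (↭-reflexive (map-cong embed₁-label _)) (bijective ρ₁ x))
        where
        embed₁-label : ∀ h → label-combined (embed₁ U h) ≡ label ρ₁ h
        embed₁-label (e , s) = cong (λ e' → edgeLabel e' s) (strictlyInverseʳ (edges U) (inj₁ e))
      ... | inj₂ y | refl = ↭-trans (labelsAt-inj₁ (DisjointUnion-swap U) label-combined y)
                              (↭-trans (↭-reflexive (map-cong embed₂-label _)) (bijective ρ₂ y))
        where
        embed₂-label : ∀ h → label-combined (embed₁ (DisjointUnion-swap U) h) ≡ label ρ₂ h
        embed₂-label (e , s) = cong (λ e' → edgeLabel e' s) (strictlyInverseʳ (edges U) (inj₂ e))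

    distribution-combine : ∀ k → distribution combine k ≡ distribution ρ₁ k + distribution ρ₂ k
    distribution-combine k = trans (fibreSize-split (vertices U) τ-combined k)
      (cong₂ _+_ (fibreSize-cong (λ x → cong [ τ ρ₁ , τ ρ₂ ]′ (strictlyInverseʳ (vertices U) (inj₁ x))) k)
                 (fibreSize-cong (λ y → cong [ τ ρ₁ , τ ρ₂ ]′ (strictlyInverseʳ (vertices U) (inj₂ y))) k))

module _ {n a b} {G : Graph n} {G₁ : Graph a} {G₂ : Graph b} (U : DisjointUnion G G₁ G₂) {j} {P : Pot j} where

  restrict₂ : Realization P G → Realization P G₂
  restrict₂ = restrict₁ (DisjointUnion-swap U)

  distribution-restrict : ∀ (ρ : Realization P G) k →
    distribution ρ k ≡ distribution (restrict₁ U ρ) k + distribution (restrict₂ ρ) k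
  distribution-restrict ρ = fibreSize-split (vertices U) (τ ρ)

module _ {n a b} {G : Graph n} {G₁ : Graph a} {G₂ : Graph b} (U : DisjointUnion G G₁ G₂) where

  private
    isLeft : ∀ {A B : Set} → A ⊎ B → Bool
    isLeft = [ (λ _ → true) , (λ _ → false) ]′

    isLeft-end : ∀ e s → isLeft (from (vertices U) (end G e s)) ≡ isLeft (from (edges U) e)
    isLeft-end e s with from (edges U) e | strictlyInverseˡ (edges U) e
    ... | inj₁ e₁ | refl = cong isLeft (trans (cong (from (vertices U)) (end-inj₁ U e₁ s)) (strictlyInverseʳ (vertices U) _))
    ... | inj₂ e₂ | refl = cong isLeft (trans (cong (from (vertices U)) (end-inj₂ U e₂ s)) (strictlyInverseʳ (vertices U) _))

    isLeft-reachable : ∀ {w w'} → Reachable G w w' → isLeft (from (vertices U) w) ≡ isLeft (from (vertices U) w')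
    isLeft-reachable here = refl
    isLeft-reachable (step (e , s , refl , refl) r) = trans (trans (isLeft-end e s) (sym (isLeft-end e (not s)))) (isLeft-reachable r)

  DisjointUnion-disconnected : Disconnected G
  DisjointUnion-disconnected = u , v , λ r → true≢false (begin
    true                             ≡⟨ cong isLeft (sym (strictlyInverseʳ (vertices U) _)) ⟩
    isLeft (from (vertices U) u)     ≡⟨ isLeft-reachable r ⟩
    isLeft (from (vertices U) v)     ≡⟨ cong isLeft (strictlyInverseʳ (vertices U) _) ⟩
    false                            ∎)
    where
    open ≡-Reasoning
    u v : Fin n
    u = to (vertices U) (inj₁ (fromℕ< (nonempty G₁)))
    v = to (vertices U) (inj₂ (fromℕ< (nonempty G₂)))
    true≢false : true ≢ false
    true≢false ()

module _ {a b} (G₁ : Graph a) (G₂ : Graph b) where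

  private
    ⊕-end : Fin (m G₁) ⊎ Fin (m G₂) → Bool → Fin (a + b)
    ⊕-end e s = to (↔-sym +↔⊎) (Sum.map (λ e₁ → end G₁ e₁ s) (λ e₂ → end G₂ e₂ s) e)

    ⊕-loopless : ∀ e → ⊕-end e false ≢ ⊕-end e true
    ⊕-loopless (inj₁ e) eq = loopless G₁ e (inj₁-injective (inverse-injective (↔-sym +↔⊎) eq))
    ⊕-loopless (inj₂ e) eq = loopless G₂ e (inj₂-injective (inverse-injective (↔-sym +↔⊎) eq))

  _⊕_ : Graph (a + b)
  _⊕_ = record
    { nonempty = ≤-trans (nonempty G₁) (m≤m+n a b)
    ; m        = m G₁ + m G₂
    ; end      = λ e → ⊕-end (from (↔-sym +↔⊎) e)
    ; loopless = λ e → ⊕-loopless (from (↔-sym +↔⊎) e)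
    }

  ⊕-disjointUnion : DisjointUnion _⊕_ G₁ G₂
  ⊕-disjointUnion = record
    { vertices = ↔-sym +↔⊎
    ; edges    = ↔-sym +↔⊎
    ; end-inj₁ = λ e s → cong (λ e' → ⊕-end e' s) (strictlyInverseˡ +↔⊎ (inj₁ e))
    ; end-inj₂ = λ e s → cong (λ e' → ⊕-end e' s) (strictlyInverseˡ +↔⊎ (inj₂ e))
    }

record Partition (n : ℕ) (P Q : Pred (Fin n) 0ℓ) : Set where
  field
    left right : ℕ
    parts      : (Fin left ⊎ Fin right) ↔ Fin n
    left-P     : ∀ x → P (to parts (inj₁ x))
    right-Q    : ∀ y → Q (to parts (inj₂ y))

open Partition

Partition-swap : ∀ {n P Q} → Partition n P Q → Partition n Q P
Partition-swap R = record
  { left = right R ; right = left R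
  ; parts = ↔-trans (⊎-comm _ _) (parts R)
  ; left-P = right-Q R ; right-Q = left-P R
  }

Partition-consˡ : ∀ {n P Q} → P zero → Partition n (P ∘ suc) (Q ∘ suc) → Partition (suc n) P Q
Partition-consˡ P0 R = record
  { left = suc (left R) ; right = right R
  ; parts = ↔-trans (+↔⊎ {1} ⊎-↔ ↔-refl) (↔-trans (⊎-assoc _ _ _ _)
              (↔-trans (↔-refl ⊎-↔ parts R) (↔-sym (+↔⊎ {1}))))
  ; left-P = λ { zero → P0 ; (suc x) → left-P R x }
  ; right-Q = right-Q R
  }

Partition-consʳ : ∀ {n P Q} → Q zero → Partition n (P ∘ suc) (Q ∘ suc) → Partition (suc n) P Q
Partition-consʳ Q0 = Partition-swap ∘ Partition-consˡ Q0 ∘ Partition-swap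

partition : ∀ {n} {P : Pred (Fin n) 0ℓ} → Decidable P → Partition n P (∁ P)
partition {zero}  P? = record
  { left = 0 ; right = 0 ; parts = ↔-sym +↔⊎ ; left-P = λ () ; right-Q = λ () }
partition {suc n} P? with P? zero
... | yes P0 = Partition-consˡ P0 (partition (P? ∘ suc))
... | no ¬P0 = Partition-consʳ ¬P0 (partition (P? ∘ suc))

module _ {n} {P : Pred (Fin n) 0ℓ} (R : Partition n P (∁ P)) where

  left⁻¹ : ∀ {w} → P w → Σ (Fin (left R)) λ x → to (parts R) (inj₁ x) ≡ w
  left⁻¹ {w} Pw with from (parts R) w | strictlyInverseˡ (parts R) w
  ... | inj₁ x | eq = x , eq
  ... | inj₂ y | eq = ⊥-elim (right-Q R y (subst P (sym eq) Pw))

  right⁻¹ : ∀ {w} → ¬ P w → Σ (Fin (right R)) λ y → to (parts R) (inj₂ y) ≡ w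
  right⁻¹ {w} ¬Pw with from (parts R) w | strictlyInverseˡ (parts R) w
  ... | inj₁ x | eq = ⊥-elim (¬Pw (subst P eq (left-P R x)))
  ... | inj₂ y | eq = y , eq

subgraph : ∀ {n a k} (G : Graph n) → 0 < a → (ι : Fin a → Fin n) (ε : Fin k → Fin (m G))
  (end' : Fin k → Bool → Fin a) → (∀ e s → ι (end' e s) ≡ end G (ε e) s) → Graph a
subgraph {k = k} G 0<a ι ε end' ι-end = record
  { nonempty = 0<a
  ; m        = k
  ; end      = end'
  ; loopless = λ e eq → loopless G (ε e) (trans (sym (ι-end e false)) (trans (cong ι eq) (ι-end e true)))
  }

module _ {n} (G : Graph n) {P : Pred (Fin n) 0ℓ} (P? : Decidable P)
  (P-closed : ∀ e s → P (end G e s) → P (end G e (not s))) where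

  private
    V : Partition n P (∁ P)
    V = partition P?
    E : Partition (m G) (λ e → P (end G e false)) (∁ (λ e → P (end G e false)))
    E = partition (λ e → P? (end G e false))

    end-P : ∀ e s → P (end G (to (parts E) (inj₁ e)) s)
    end-P e false = left-P E e
    end-P e true  = P-closed _ false (left-P E e)

    end-¬P : ∀ e s → ¬ P (end G (to (parts E) (inj₂ e)) s)
    end-¬P e false = right-Q E e
    end-¬P e true  = right-Q E e ∘ P-closed _ true

  splitAlong : ∀ {u v} → P u → ¬ P v →
    Σ ℕ λ a → Σ ℕ λ b → Σ (Graph a) λ G₁ → Σ (Graph b) λ G₂ → DisjointUnion G G₁ G₂
  splitAlong Pu ¬Pv = left V , right V , G₁ , G₂ , record
    { vertices = parts V
    ; edges    = parts E
    ; end-inj₁ = λ e s → sym (proj₂ (left⁻¹ V (end-P e s)))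
    ; end-inj₂ = λ e s → sym (proj₂ (right⁻¹ V (end-¬P e s)))
    }
    where
    G₁ : Graph (left V)
    G₁ = subgraph G (Fin⇒0< (proj₁ (left⁻¹ V Pu))) (to (parts V) ∘ inj₁) (to (parts E) ∘ inj₁)
           (λ e s → proj₁ (left⁻¹ V (end-P e s))) (λ e s → proj₂ (left⁻¹ V (end-P e s)))
    G₂ : Graph (right V)
    G₂ = subgraph G (Fin⇒0< (proj₁ (right⁻¹ V ¬Pv))) (to (parts V) ∘ inj₂) (to (parts E) ∘ inj₂)
           (λ e s → proj₁ (right⁻¹ V (end-¬P e s))) (λ e s → proj₂ (right⁻¹ V (end-¬P e s)))

module _ {n} (G : Graph n) where

  reachable-snoc : ∀ {u v w} → Reachable G u v → Adjacent G v w → Reachable G u w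
  reachable-snoc here         vw = step vw here
  reachable-snoc (step uv' r) vw = step uv' (reachable-snoc r vw)

  reachable-across : ∀ {u} e s → Reachable G u (end G e s) → Reachable G u (end G e (not s))
  reachable-across e s r = reachable-snoc r (e , s , refl , refl)

  Closed : Subset n → Set
  Closed S = ∀ e s → end G e s ∈ₛ S → end G e (not s) ∈ₛ S

  LeavesAt : Subset n → Fin (m G) → Bool → Set
  LeavesAt S e s = end G e s ∈ₛ S × end G e (not s) ∉ₛ S

  Leaving : Subset n → Fin (m G) → Set
  Leaving S e = ∃ (LeavesAt S e)

  leaving? : ∀ S e → Dec (Leaving S e)
  leaving? S e = map′ witness split (leavesAt false ⊎-dec leavesAt true)
    where
    leavesAt : ∀ s → Dec (LeavesAt S e s)
    leavesAt s = (end G e s ∈? S) ×-dec ¬? (end G e (not s) ∈? S)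
    witness : LeavesAt S e false ⊎ LeavesAt S e true → Leaving S e
    witness (inj₁ p) = false , p
    witness (inj₂ p) = true , p
    split : Leaving S e → LeavesAt S e false ⊎ LeavesAt S e true
    split (false , p) = inj₁ p
    split (true  , p) = inj₂ p

  closed-or-leaving : ∀ S → Closed S ⊎ ∃ (Leaving S)
  closed-or-leaving S with any? (leaving? S)
  ... | yes l  = inj₂ l
  ... | no ¬l  = inj₁ S-closed
    where
    S-closed : Closed S
    S-closed e s x∈S with end G e (not s) ∈? S
    ... | yes y∈S = y∈S
    ... | no  y∉S = ⊥-elim (¬l (e , s , x∈S , y∉S))

  closed-reachable : ∀ {S x w} → Closed S → x ∈ₛ S → Reachable G x w → w ∈ₛ S
  closed-reachable S-closed x∈S here                          = x∈S
  closed-reachable S-closed x∈S (step (e , s , refl , refl) r) = closed-reachable S-closed (S-closed e s x∈S) r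

  module _ (u : Fin n) where

    Sound : Subset n → Set
    Sound S = ∀ w → w ∈ₛ S → Reachable G u w

    -- The fuel k exceeds the number of vertices missing from S, so it never runs out.
    closure : ∀ k S → n < k + ∣ S ∣ → u ∈ₛ S → Sound S → Σ (Subset n) λ S' → u ∈ₛ S' × Sound S' × Closed S'
    closure zero    S n<∣S∣ _ _ = ⊥-elim (<⇒≱ n<∣S∣ (∣p∣≤n S))
    closure (suc k) S n<1+k+∣S∣ u∈S sound with closed-or-leaving S
    ... | inj₁ S-closed = S , u∈S , sound , S-closed
    ... | inj₂ (e , s , x∈S , y∉S) = closure k S' n<k+∣S'∣ (x∈p∪q⁺ (inj₁ u∈S)) sound'
      where
      y : Fin n
      y = end G e (not s)
      S' : Subset n
      S' = S ∪ ⁅ y ⁆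
      ∣S∣<∣S'∣ : ∣ S ∣ < ∣ S' ∣
      ∣S∣<∣S'∣ = p⊂q⇒∣p∣<∣q∣ (p⊆p∪q ⁅ y ⁆ , y , x∈p∪q⁺ (inj₂ (x∈⁅x⁆ y)) , y∉S)
      n<k+∣S'∣ : n < k + ∣ S' ∣
      n<k+∣S'∣ = <-≤-trans n<1+k+∣S∣ (subst (_≤ k + ∣ S' ∣) (+-suc k ∣ S ∣) (+-monoʳ-≤ k ∣S∣<∣S'∣))
      sound' : Sound S'
      sound' w w∈S' with x∈p∪q⁻ S ⁅ y ⁆ w∈S'
      ... | inj₁ w∈S = sound w w∈S
      ... | inj₂ w∈y = subst (Reachable G u) (sym (x∈⁅y⁆⇒x≡y y w∈y)) (reachable-across e s (sound _ x∈S))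

    reachable? : Decidable (Reachable G u)
    reachable? w with closure n ⁅ u ⁆ n<n+1 (x∈⁅x⁆ u) sound₀
      where
      n<n+1 : n < n + ∣ ⁅ u ⁆ ∣
      n<n+1 = m<m+n n (subst (0 <_) (sym (∣⁅x⁆∣≡1 u)) (s≤s z≤n))
      sound₀ : Sound ⁅ u ⁆
      sound₀ w w∈u = subst (Reachable G u) (sym (x∈⁅y⁆⇒x≡y u w∈u)) here
    ... | S , u∈S , sound , S-closed = map′ (sound w) (closed-reachable S-closed u∈S) (w ∈? S)

sum-map-allFin : ∀ {r} (f : Fin r → ℕ) → sum (map f (allFin r)) ≡ sum (tabulate f)
sum-map-allFin f = cong sum (map-tabulate id f)

sum-tabulate-0 : ∀ r → sum (tabulate {n = r} (λ _ → 0)) ≡ 0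
sum-tabulate-0 zero    = refl
sum-tabulate-0 (suc r) = sum-tabulate-0 r

sum-tabulate-+ : ∀ {r} (f g : Fin r → ℕ) → sum (tabulate (λ i → f i + g i)) ≡ sum (tabulate f) + sum (tabulate g)
sum-tabulate-+ {zero}  f g = refl
sum-tabulate-+ {suc r} f g = trans (cong (f zero + g zero +_) (sum-tabulate-+ (f ∘ suc) (g ∘ suc)))
                                   (+-interchange (f zero) (g zero) _ _)

indicator : ∀ {j} → Fin j → Fin j → ℕ
indicator c k = if does (c ≟F k) then 1 else 0

sum-indicator : ∀ {j} (c : Fin j) → sum (tabulate (indicator c)) ≡ 1
sum-indicator {suc j} zero    = cong suc (sum-tabulate-0 j)
sum-indicator         (suc c) = sum-indicator c

sum-fibres : ∀ {A : Set} {j} (τ : A → Fin j) xs →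
  sum (tabulate (λ k → length (filter (λ x → τ x ≟F k) xs))) ≡ length xs
sum-fibres {j = j} τ []       = sum-tabulate-0 j
sum-fibres {A} {j} τ (x ∷ xs) = begin
  sum (tabulate (count (x ∷ xs)))                               ≡⟨ cong sum (tabulate-cong count-∷) ⟩
  sum (tabulate (λ k → indicator (τ x) k + count xs k))         ≡⟨ sum-tabulate-+ (indicator (τ x)) (count xs) ⟩
  sum (tabulate (indicator (τ x))) + sum (tabulate (count xs))  ≡⟨ cong₂ _+_ (sum-indicator (τ x)) (sum-fibres τ xs) ⟩
  suc (length xs)                                               ∎
  where
  open ≡-Reasoning
  count : List A → Fin j → ℕ
  count ys k = length (filter (λ y → τ y ≟F k) ys)
  count-∷ : ∀ k → count (x ∷ xs) k ≡ indicator (τ x) k + count xs k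
  count-∷ k with τ x ≟F k
  ... | yes _ = refl
  ... | no  _ = refl

sum-distribution : ∀ {j n} {P : Pot j} {G : Graph n} (ρ : Realization P G) → sum (tabulate (distribution ρ)) ≡ n
sum-distribution {n = n} ρ = trans (sum-fibres (τ ρ) (allFin n)) (length-tabulate id)

module _ {j} (P : Pot j) where

  sum-tileDistribution : ∀ {n R} → IsTileDistribution P n R → sum (tabulate R) ≡ n
  sum-tileDistribution (G , ρ , dist≡R) = trans (cong sum (tabulate-cong (sym ∘ dist≡R))) (sum-distribution ρ)

  tileDistribution-order-unique : ∀ {a b R R'} → (∀ k → R k ≡ R' k) →
    IsTileDistribution P a R → IsTileDistribution P b R' → a ≡ b
  tileDistribution-order-unique R≗R' t t' =
    trans (sym (sum-tileDistribution t)) (trans (cong sum (tabulate-cong R≗R')) (sum-tileDistribution t'))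

  tileDistribution-resp : ∀ {n R R'} → (∀ k → R k ≡ R' k) → IsTileDistribution P n R → IsTileDistribution P n R'
  tileDistribution-resp R≗R' (G , ρ , dist≡R) = G , ρ , λ k → trans (dist≡R k) (R≗R' k)

  tileDistribution-⊕ : ∀ {a b R₁ R₂} → IsTileDistribution P a R₁ → IsTileDistribution P b R₂ →
    IsTileDistribution P (a + b) (λ k → R₁ k + R₂ k)
  tileDistribution-⊕ (G₁ , ρ₁ , d₁) (G₂ , ρ₂ , d₂) =
    G₁ ⊕ G₂ , combine U ρ₁ ρ₂ , λ k → trans (distribution-combine U ρ₁ ρ₂ k) (cong₂ _+_ (d₁ k) (d₂ k))
    where
    U : DisjointUnion (G₁ ⊕ G₂) G₁ G₂
    U = ⊕-disjointUnion G₁ G₂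

  tileDistribution-sum : ∀ r {ord : Fin (suc r) → ℕ} {Rs : Fin (suc r) → Fin j → ℕ} →
    (∀ i → IsTileDistribution P (ord i) (Rs i)) → ∃[ N ] IsTileDistribution P N (λ k → sum (tabulate (λ i → Rs i k)))
  tileDistribution-sum zero    td = _ , tileDistribution-resp (λ _ → sym (+-identityʳ _)) (td zero)
  tileDistribution-sum (suc r) td = _ , tileDistribution-⊕ (td zero) (proj₂ (tileDistribution-sum r (td ∘ suc)))

  decomposesBelow-two : ∀ {n a b R R₁ R₂} → IsTileDistribution P a R₁ → IsTileDistribution P b R₂ →
    a < n → b < n → (∀ k → R k ≡ R₁ k + R₂ k) → DecomposesBelow P n R
  decomposesBelow-two {a = a} {b} {R₁ = R₁} {R₂} t₁ t₂ a<n b<n R≡ =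
    2 , (λ { zero → a ; (suc _) → b }) , (λ { zero → R₁ ; (suc _) → R₂ }) ,
    (λ { zero → a<n ; (suc zero) → b<n }) , (λ { zero → t₁ ; (suc zero) → t₂ }) ,
    λ k → trans (R≡ k) (cong (R₁ k +_) (sym (+-identityʳ (R₂ k))))

  realizesDisconnected⇒decomposesBelow : ∀ {n} → RealizesDisconnected P n →
    Σ (Fin j → ℕ) (λ R → IsTileDistribution P n R × DecomposesBelow P n R)
  realizesDisconnected⇒decomposesBelow (G , (u , v , u↛v) , ρ)
    with a , b , G₁ , G₂ , U ← splitAlong G (reachable? G u) (reachable-across G) here u↛v =
    distribution ρ , (G , ρ , λ _ → refl) ,
    decomposesBelow-two (G₁ , restrict₁ U ρ , λ _ → refl) (G₂ , restrict₂ U ρ , λ _ → refl)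
      (subst (a <_) (DisjointUnion-order U) (m<m+n a (nonempty G₂)))
      (subst (b <_) (DisjointUnion-order U) (m<n+m b (nonempty G₁)))
      (distribution-restrict U ρ)

  decomposesBelow⇒realizesDisconnected : ∀ {n} →
    Σ (Fin j → ℕ) (λ R → IsTileDistribution P n R × DecomposesBelow P n R) → RealizesDisconnected P n
  decomposesBelow⇒realizesDisconnected {n} (R , t , zero , ord , Rs , ord<n , td , R≡) =
    ⊥-elim (<-irrefl (sym n≡0) (nonempty (proj₁ t)))
    where
    n≡0 : n ≡ 0
    n≡0 = trans (sym (sum-tileDistribution t)) (trans (cong sum (tabulate-cong R≡)) (sum-tabulate-0 j))
  decomposesBelow⇒realizesDisconnected {n} (R , t , suc zero , ord , Rs , ord<n , td , R≡) =
    ⊥-elim (<-irrefl ord₀≡n (ord<n zero))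
    where
    ord₀≡n : ord zero ≡ n
    ord₀≡n = tileDistribution-order-unique (λ k → sym (trans (R≡ k) (+-identityʳ _))) (td zero) t
  decomposesBelow⇒realizesDisconnected {n} (R , t , suc (suc r) , ord , Rs , ord<n , td , R≡)
    with G₀ , ρ₀ , d₀ ← td zero
       | N , H , ρH , dH ← tileDistribution-sum r (td ∘ suc) =
    subst (RealizesDisconnected P) order≡n (G₀ ⊕ H , DisjointUnion-disconnected U , combine U ρ₀ ρH)
    where
    U : DisjointUnion (G₀ ⊕ H) G₀ H
    U = ⊕-disjointUnion G₀ H
    dist≡R : ∀ k → distribution (combine U ρ₀ ρH) k ≡ R k
    dist≡R k = trans (distribution-combine U ρ₀ ρH k)
      (trans (cong₂ _+_ (d₀ k) (dH k)) (sym (trans (R≡ k) (sum-map-allFin (λ i → Rs i k)))))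
    order≡n : ord zero + N ≡ n
    order≡n = tileDistribution-order-unique (λ _ → refl) (G₀ ⊕ H , combine U ρ₀ ρH , dist≡R) t

theorem3 : ∀ {j} (P : Pot j) (n : ℕ) →
    RealizesDisconnected P n ⇔
      Σ (Fin j → ℕ) (λ R → IsTileDistribution P n R × DecomposesBelow P n R)
theorem3 P n = mk⇔ (realizesDisconnected⇒decomposesBelow P) (decomposesBelow⇒realizesDisconnected P)
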